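{- Let $n_0$ be a positive integer such that for every $n \ge n_0$, every $k \le n$ and every real $m \ge 5$, every $k\times n$ $\{0,1\}$-matrix with $mnk^{1/2}$ entries equal to $1$ contains at least $n^2m^4/5$ occurrences of $S$. Let $n \ge n_0$ and $k \le n$ be positive integers. Let $\mathcal{U}$ be a reverse-free set of $k \times n$ word matrices with $m_{\mathcal{U}} \ge 5$ such that $A_{\mathcal{U}}$ has no light $1$-entry. Then there exists a set $\mathcal{U}' \subset \mathcal{U}$ satisfying \[ |\mathcal{U}'| \ge \frac{|\mathcal{U}|}{n},\qquad |A_{\mathcal{U}'}| \le |A_{\mathcal{U}}|-\frac{2n m_{\mathcal{U}}^3}{5k^{1/2}},\qquad z_{\mathcal{U}'} \ge z_{\mathcal{U}}+1. \]
   Context: $S$ denotes the $2\times2$ all-ones matrix; an occurrence of $S$ in a $\{0,1\}$-matrix is a choice of two distinct rows and two distinct columns such that all four entries at their intersections are $1$. A $k\times n$ word matrix is a $k\times n$ $\{0,1\}$-matrix with exactly one $1$-entry in each row; it corresponds to the word $(u_1,\dots,u_k)\in[n]^k$ where $u_i$ is the column of the $1$-entry in row $i$. Two words $w,x$ of length $k$ have a reverse if there are positions $i,j$ with $w_i\ne w_j$, $w_i=x_j$, $w_j=x_i$; a set of word matrices is reverse-free if no two of the corresponding words have a reverse. For a set $\mathcal{U}$ of $k\times n$ word matrices, the overall matrix $A_{\mathcal{U}}$ is the $k\times n$ $\{0,1\}$-matrix with a $1$ exactly at those positions where at least one matrix of $\mathcal{U}$ has a $1$; $|A_{\mathcal{U}}|$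 is its number of $1$-entries; the density is $m_{\mathcal{U}}=|A_{\mathcal{U}}|/(nk^{1/2})$. A $1$-entry of $A_{\mathcal{U}}$ at position $(r,c)$ is light if the number of matrices in $\mathcal{U}$ having a $1$ at $(r,c)$ is at most $|\mathcal{U}|/n$. The emptiness $z_{\mathcal{U}}$ is the number of rows of $A_{\mathcal{U}}$ containing at most one $1$-entry. -}

module Defs where

open import Data.Bool using (Bool; true; false; _∧_)
open import Data.Nat using (ℕ; zero; suc; _+_; _*_; _^_; _≤_; _<_; _<ᵇ_; _≤ᵇ_)
open import Data.Fin using (Fin; toℕ)
open import Data.Fin.Properties using (_≟_)
open import Data.Vec using (Vec; lookup)
open import Data.List using (List; length; filterᵇ; map; allFin)
open import Data.Nat.ListAction using (sum)
open import Data.Bool.ListAction using (any)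
open import Data.List.Membership.Propositional using (_∈_)
open import Data.Product using (Σ; ∃; _×_)
open import Relation.Nullary using (¬_; ⌊_⌋)
open import Relation.Binary.PropositionalEquality using (_≡_; _≢_)

Matrix : ℕ → ℕ → Set
Matrix k n = Fin k → Fin n → Bool

count : ∀ {A : Set} → (A → Bool) → List A → ℕ
count p xs = length (filterᵇ p xs)

ones : ∀ {k n} → Matrix k n → ℕ
ones {k} {n} M = sum (map (λ r → count (M r) (allFin n)) (allFin k))

rowOnes : ∀ {k n} → Matrix k n → Fin k → ℕ
rowOnes {k} {n} M r = count (M r) (allFin n)

-- number of occurrences of S (2×2 all-ones): rows r1<r2, columns c1<c2, all four entries 1
occS : ∀ {k n} → Matrix k n → ℕ
occS {k} {n} M =
  sum (map (λ r1 → sum (map (λ r2 → sum (map (λ c1 → count (λ c2 →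
      (toℕ r1 <ᵇ toℕ r2) ∧ (toℕ c1 <ᵇ toℕ c2) ∧
      M r1 c1 ∧ M r1 c2 ∧ M r2 c1 ∧ M r2 c2) (allFin n)) (allFin n))) (allFin k))) (allFin k))

-- a word u ∈ [n]^k, i.e. a k×n word matrix (row i has its unique 1 in column u_i)
Word : ℕ → ℕ → Set
Word k n = Vec (Fin n) k

wordMatrix : ∀ {k n} → Word k n → Matrix k n
wordMatrix w r c = ⌊ lookup w r ≟ c ⌋

HasReverse : ∀ {k n} → Word k n → Word k n → Set
HasReverse w x = ∃ λ i → ∃ λ j →
  (lookup w i ≢ lookup w j) × (lookup w i ≡ lookup x j) × (lookup w j ≡ lookup x i)

ReverseFree : ∀ {k n} → List (Word k n) → Set
ReverseFree U = ∀ w x → w ∈ U → x ∈ U → ¬ HasReverse w x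

overall : ∀ {k n} → List (Word k n) → Matrix k n
overall U r c = any (λ w → wordMatrix w r c) U

hits : ∀ {k n} → List (Word k n) → Fin k → Fin n → ℕ
hits U r c = count (λ w → wordMatrix w r c) U

sizeA : ∀ {k n} → List (Word k n) → ℕ
sizeA U = ones (overall U)

-- (r,c) is a light 1-entry of A_U: a 1-entry with hits ≤ |U|/n, i.e. n·hits ≤ |U|
Light : ∀ {k n} → List (Word k n) → Fin k → Fin n → Set
Light {k} {n} U r c = (overall U r c ≡ true) × (n * hits U r c ≤ length U)

NoLight : ∀ {k n} → List (Word k n) → Set
NoLight U = ∀ r c → ¬ Light U r c

emptiness : ∀ {k n} → List (Word k n) → ℕ
emptiness {k} U = count (λ r → rowOnes (overall U) r ≤ᵇ 1) (allFin k)

-- density hypothesis m ≥ 5 for a k×n matrix with N ones, m = N/(n√k):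
-- N ≥ 5 n √k  ⇔  25 n² k ≤ N²   (all quantities nonnegative)
DensityAtLeast5 : ℕ → ℕ → ℕ → Set
DensityAtLeast5 n k N = 25 * (n ^ 2) * k ≤ N ^ 2

-- hypothesis on n₀: for n ≥ n₀, 1 ≤ k ≤ n, every k×n matrix with m n √k ones (m ≥ 5)
-- has ≥ n² m⁴/5 occurrences of S; with m = N/(n√k): N⁴ ≤ 5 n² k² · occS
SupersatHyp : ℕ → Set
SupersatHyp n₀ = ∀ n k → n₀ ≤ n → 1 ≤ k → k ≤ n → (M : Matrix k n) →
  DensityAtLeast5 n k (ones M) → ones M ^ 4 ≤ 5 * (n ^ 2) * (k ^ 2) * occS M

-- Write A = A_U, N = |A|, and for a row r and a column c let U_{r,c} be the
-- words of U whose letter at position r is c.  Passing from U to U_{r,c}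
-- keeps hits U r c > |U|/n words (no entry of A is light), leaves a single 1
-- in row r of the overall matrix (so the emptiness grows as soon as row r of
-- A had two 1s), and loses some number loss(r,c) of the 1-entries of A.
-- The heart of the proof is the estimate
--     #rectangles of A through row r  ≤  Σ_{c : A r c = 1} loss(r,c):
-- by reverse-freeness, for every occurrence of S on rows r, r' and columns
-- c < c', the entry (r',c') is lost in U_{r,c} or the entry (r',c) is lost
-- in U_{r,c'}.  Two averaging steps then give a row r and a 1-entry (r,c)
-- with loss(r,c) ≥ 2·occS(A)/N, and the supersaturation hypothesis
-- N⁴ ≤ 5n²k²·occS(A) turns this into loss(r,c) ≥ 2N³/(5n²k²).

module Submission where

open import Defs
open import Data.Nat using (ℕ; _+_; _*_; _^_; _≤_; _<_)
open import Data.List using (List; length)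
open import Data.List.Relation.Unary.Unique.Propositional using (Unique)
open import Data.List.Relation.Binary.Sublist.Propositional using (_⊆_)
open import Data.Product using (Σ; _×_)

open import Data.Bool using (Bool; true; false; _∧_; not; T; T?)
open import Data.Bool.Properties using (∧-assoc; ∧-comm; T-≡)
open import Data.Nat using (zero; suc; z≤n; s≤s; z<s; _<ᵇ_; _≤ᵇ_; _≤?_; _<?_; >-nonZero)
open import Data.Nat.Properties hiding (suc-injective)
open import Data.Nat.ListAction using () renaming (sum to listSum)
open import Data.Fin using (Fin; zero; suc; toℕ)
open import Data.Fin.Properties using (any?; suc-injective) renaming (_≟_ to _≟ᶠ_)
open import Data.Vec using (lookup)
open import Data.List using ([]; _∷_; map; allFin; tabulate; filterᵇ)
open import Data.List.Membership.Propositional using (_∈_; find; lose)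
open import Data.List.Membership.Propositional.Properties using (∈-filter⁻)
open import Data.List.Relation.Unary.Any.Properties using (any⁺; any⁻)
open import Data.List.Relation.Binary.Sublist.Propositional.Properties using (filter-⊆)
open import Data.Product using (∃-syntax; _,_)
open import Data.Empty using (⊥; ⊥-elim)
open import Data.Unit using (tt)
open import Function using (_∘_; Equivalence)
open import Relation.Nullary using (¬_; yes; no; contradiction)
open import Relation.Nullary.Decidable using (_×-dec_; toWitness; fromWitness)
open import Relation.Binary.PropositionalEquality
  using (_≡_; _≢_; refl; sym; trans; cong; cong₂; subst; module ≡-Reasoning)
open import Algebra.Properties.Semiring.Sum +-*-semiring
  using (sum-cong-≗; ∑-distrib-+; ∑-comm; *-distribˡ-sum; *-distribʳ-sum)
  renaming (sum to ∑)
open import Algebra.Properties.CommutativeSemigroup *-commutativeSemigroup using (x∙yz≈y∙xz)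
open import Data.Nat.Solver using (module +-*-Solver)

*-pos : ∀ {m n} → 0 < m → 0 < n → 0 < m * n
*-pos = *-mono-≤

pos-*ˡ : ∀ m {n} → 0 < m * n → 0 < m
pos-*ˡ (suc m) _ = z<s

pos-*ʳ : ∀ m {n} → 0 < m * n → 0 < n
pos-*ʳ m {n} 0<mn = pos-*ˡ n (subst (0 <_) (*-comm m n) 0<mn)

^-pos : ∀ {m} e → 0 < m → 0 < m ^ e
^-pos e 0<m = m^n>0 _ {{>-nonZero 0<m}} e

pos-of-pow : ∀ {a} N e → 0 < a → a ≤ N ^ suc e → 0 < N
pos-of-pow zero    e 0<a a≤0 = <-≤-trans 0<a a≤0
pos-of-pow (suc N) e _   _   = z<s

∑₂ : ∀ {m n} → (Fin m → Fin n → ℕ) → ℕ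
∑₂ F = ∑ λ i → ∑ (F i)

∑-mono : ∀ {n} {f g : Fin n → ℕ} → (∀ i → f i ≤ g i) → ∑ f ≤ ∑ g
∑-mono {zero}  f≤g = z≤n
∑-mono {suc n} f≤g = +-mono-≤ (f≤g zero) (∑-mono (f≤g ∘ suc))

∑₂-mono : ∀ {m n} {F G : Fin m → Fin n → ℕ} → (∀ i j → F i j ≤ G i j) → ∑₂ F ≤ ∑₂ G
∑₂-mono F≤G = ∑-mono λ i → ∑-mono (F≤G i)

∑-mono-< : ∀ {n} {f g : Fin n → ℕ} → (∀ i → f i ≤ g i) → ∀ j → f j < g j → ∑ f < ∑ g
∑-mono-< f≤g zero    fj<gj = +-mono-<-≤ fj<gj (∑-mono (f≤g ∘ suc))
∑-mono-< f≤g (suc j) fj<gj = +-mono-≤-< (f≤g zero) (∑-mono-< (f≤g ∘ suc) j fj<gj)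

∑₂-cong : ∀ {m n} {F G : Fin m → Fin n → ℕ} → (∀ i j → F i j ≡ G i j) → ∑₂ F ≡ ∑₂ G
∑₂-cong F≡G = sum-cong-≗ λ i → sum-cong-≗ (F≡G i)

∑₂-distrib-+ : ∀ {m n} (F G : Fin m → Fin n → ℕ) →
  ∑₂ (λ i j → F i j + G i j) ≡ ∑₂ F + ∑₂ G
∑₂-distrib-+ F G =
  trans (sum-cong-≗ λ i → ∑-distrib-+ (F i) (G i)) (∑-distrib-+ (λ i → ∑ (F i)) (λ i → ∑ (G i)))

∑₂-*ˡ : ∀ {m n} x (F : Fin m → Fin n → ℕ) → x * ∑₂ F ≡ ∑₂ (λ i j → x * F i j)
∑₂-*ˡ x F = trans (*-distribˡ-sum x (λ i → ∑ (F i))) (sum-cong-≗ λ i → *-distribˡ-sum x (F i))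

term≤∑ : ∀ {n} (f : Fin n → ℕ) i → f i ≤ ∑ f
term≤∑ f zero    = m≤m+n (f zero) _
term≤∑ f (suc i) = m≤n⇒m≤o+n (f zero) (term≤∑ (f ∘ suc) i)

two-terms≤∑ : ∀ {n} (f : Fin n → ℕ) {i j} → i ≢ j → f i + f j ≤ ∑ f
two-terms≤∑ f {zero}  {zero}  i≢j = contradiction refl i≢j
two-terms≤∑ f {zero}  {suc j} _   = +-monoʳ-≤ (f zero) (term≤∑ (f ∘ suc) j)
two-terms≤∑ f {suc i} {zero}  _   =
  subst (_≤ ∑ f) (+-comm (f zero) (f (suc i))) (+-monoʳ-≤ (f zero) (term≤∑ (f ∘ suc) i))
two-terms≤∑ f {suc i} {suc j} i≢j = m≤n⇒m≤o+n (f zero) (two-terms≤∑ (f ∘ suc) (i≢j ∘ cong suc))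

∑-zero : ∀ {n} (f : Fin n → ℕ) → (∀ j → f j ≡ 0) → ∑ f ≡ 0
∑-zero {zero}  f f≡0 = refl
∑-zero {suc n} f f≡0 = cong₂ _+_ (f≡0 zero) (∑-zero (f ∘ suc) (f≡0 ∘ suc))

∑-single : ∀ {n} (f : Fin n → ℕ) i → (∀ j → j ≢ i → f j ≡ 0) → ∑ f ≡ f i
∑-single f zero others =
  trans (cong (f zero +_) (∑-zero (f ∘ suc) λ j → others (suc j) λ ())) (+-identityʳ (f zero))
∑-single f (suc i) others =
  cong₂ _+_ (others zero λ ()) (∑-single (f ∘ suc) i λ j j≢i → others (suc j) (j≢i ∘ suc-injective))

∑-pos : ∀ {n} (f : Fin n → ℕ) → 0 < ∑ f → ∃[ i ] 0 < f i
∑-pos {suc n} f 0<∑f with f zero in eq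
... | suc _ = zero , subst (0 <_) (sym eq) z<s
... | zero  with ∑-pos (f ∘ suc) 0<∑f
...   | i , 0<fi = suc i , 0<fi

-- Averaging: if ∑ y ≤ ∑ x and ∑ x > 0, some index has y i ≤ x i and x i > 0.
-- Otherwise y dominates x everywhere, strictly at a positive term of x.
averaging : ∀ {n} (x y : Fin n → ℕ) → ∑ y ≤ ∑ x → 0 < ∑ x → ∃[ i ] y i ≤ x i × 0 < x i
averaging x y ∑y≤∑x 0<∑x with any? (λ i → y i ≤? x i ×-dec 0 <? x i) | ∑-pos x 0<∑x
... | yes found | _        = found
... | no none   | i , 0<xi = contradiction ∑y≤∑x (<⇒≱ (∑-mono-< x≤y i (x<y i 0<xi)))
  where
  x<y : ∀ i → 0 < x i → x i < y i
  x<y i 0<xi = ≰⇒> λ yi≤xi → none (i , yi≤xi , 0<xi)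
  x≤y : ∀ i → x i ≤ y i
  x≤y i with 0 <? x i
  ... | yes 0<xi = <⇒≤ (x<y i 0<xi)
  ... | no  0≮xi = ≤-trans (≮⇒≥ 0≮xi) z≤n

weighted-averaging : ∀ {n} (w b : Fin n → ℕ) a →
  ∑ w * a ≤ ∑ (λ i → w i * b i) → 0 < ∑ w * a → ∃[ i ] 0 < w i × a ≤ b i
weighted-averaging w b a hyp 0<∑wa
  with averaging (λ i → w i * b i) (λ i → w i * a)
                 (subst (_≤ _) (*-distribʳ-sum a w) hyp) (<-≤-trans 0<∑wa hyp)
... | i , wa≤wb , 0<wb = i , 0<wi , *-cancelˡ-≤ (w i) {{>-nonZero 0<wi}} wa≤wb
  where 0<wi = pos-*ˡ (w i) 0<wb

ind : Bool → ℕ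
ind true  = 1
ind false = 0

ind-∧ : ∀ a b → ind (a ∧ b) ≡ ind a * ind b
ind-∧ true  b = sym (*-identityˡ (ind b))
ind-∧ false b = refl

ind≤1 : ∀ b → ind b ≤ 1
ind≤1 true  = ≤-refl
ind≤1 false = z≤n

ind-T : ∀ {b} → T b → ind b ≡ 1
ind-T {true} _ = refl

ind-pos : ∀ {b} → 0 < ind b → T b
ind-pos {true} _ = tt

T-first-three : ∀ a b c {d} → T (a ∧ b ∧ c ∧ d) → T a × T b × T c
T-first-three true true true _ = tt , tt , tt

ind-mono : ∀ {a b} → (T a → T b) → ind a ≤ ind b
ind-mono {false}         _   = z≤n
ind-mono {true}  {true}  _   = ≤-refl
ind-mono {true}  {false} a⇒b = ⊥-elim (a⇒b tt)

ind-< : ∀ {a b} → ¬ T a → T b → ind a < ind b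
ind-< {false} {true} _ _ = z<s
ind-< {true}         ¬a _ = ⊥-elim (¬a tt)

listSum-tabulate : ∀ {n} {A : Set} (f : A → ℕ) (g : Fin n → A) →
  listSum (map f (tabulate g)) ≡ ∑ (f ∘ g)
listSum-tabulate {zero}  f g = refl
listSum-tabulate {suc n} f g = cong (f (g zero) +_) (listSum-tabulate f (g ∘ suc))

listSum-allFin : ∀ {n} (f : Fin n → ℕ) → listSum (map f (allFin n)) ≡ ∑ f
listSum-allFin f = listSum-tabulate f (λ i → i)

listSum-allFin₂ : ∀ {m n} (F : Fin m → Fin n → ℕ) →
  listSum (map (λ i → listSum (map (F i) (allFin n))) (allFin m)) ≡ ∑₂ F
listSum-allFin₂ {n = n} F =
  trans (listSum-allFin (λ i → listSum (map (F i) (allFin n)))) (sum-cong-≗ λ i → listSum-allFin (F i))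

length-filterᵇ : ∀ {A : Set} (p : A → Bool) xs → length (filterᵇ p xs) ≡ listSum (map (ind ∘ p) xs)
length-filterᵇ p []       = refl
length-filterᵇ p (x ∷ xs) with p x
... | true  = cong suc (length-filterᵇ p xs)
... | false = length-filterᵇ p xs

count-allFin : ∀ {n} (p : Fin n → Bool) → count p (allFin n) ≡ ∑ (ind ∘ p)
count-allFin p = trans (length-filterᵇ p (allFin _)) (listSum-allFin (ind ∘ p))

-- Symmetrisation.  lt i j is the indicator of i < j; summing F i j + F j i
-- over the pairs i < j counts each entry of F at most once.

lt : ∀ {n} → Fin n → Fin n → ℕ
lt i j = ind (toℕ i <ᵇ toℕ j)

lt-asym : ∀ {n} (i j : Fin n) → lt i j + lt j i ≤ 1
lt-asym i j = <ᵇ-asym (toℕ i) (toℕ j)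
  where
  <ᵇ-asym : ∀ a b → ind (a <ᵇ b) + ind (b <ᵇ a) ≤ 1
  <ᵇ-asym zero    zero    = z≤n
  <ᵇ-asym zero    (suc b) = ≤-refl
  <ᵇ-asym (suc a) zero    = ≤-refl
  <ᵇ-asym (suc a) (suc b) = <ᵇ-asym a b

<ᵇ⇒≢ : ∀ {n} {i j : Fin n} → T (toℕ i <ᵇ toℕ j) → i ≢ j
<ᵇ⇒≢ {i = i} {j} i<j refl = <-irrefl refl (<ᵇ⇒< (toℕ i) (toℕ j) i<j)

∑₂-upper-pairs : ∀ {n} (F : Fin n → Fin n → ℕ) →
  ∑₂ (λ i j → lt i j * (F i j + F j i)) ≤ ∑₂ F
∑₂-upper-pairs F = begin
  ∑₂ (λ i j → lt i j * (F i j + F j i))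
    ≡⟨ ∑₂-cong (λ i j → *-distribˡ-+ (lt i j) (F i j) (F j i)) ⟩
  ∑₂ (λ i j → lt i j * F i j + lt i j * F j i)
    ≡⟨ ∑₂-distrib-+ (λ i j → lt i j * F i j) (λ i j → lt i j * F j i) ⟩
  ∑₂ (λ i j → lt i j * F i j) + ∑₂ (λ i j → lt i j * F j i)
    ≡⟨ cong (∑₂ (λ i j → lt i j * F i j) +_) (∑-comm (λ i j → lt i j * F j i)) ⟩
  ∑₂ (λ i j → lt i j * F i j) + ∑₂ (λ i j → lt j i * F i j)
    ≡⟨ ∑₂-distrib-+ (λ i j → lt i j * F i j) (λ i j → lt j i * F i j) ⟨
  ∑₂ (λ i j → lt i j * F i j + lt j i * F i j)
    ≤⟨ ∑₂-mono once ⟩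
  ∑₂ F ∎
  where
  open ≤-Reasoning
  once : ∀ i j → lt i j * F i j + lt j i * F i j ≤ F i j
  once i j = begin
    lt i j * F i j + lt j i * F i j  ≡⟨ *-distribʳ-+ (F i j) (lt i j) (lt j i) ⟨
    (lt i j + lt j i) * F i j        ≤⟨ *-monoˡ-≤ (F i j) (lt-asym i j) ⟩
    1 * F i j                        ≡⟨ *-identityˡ (F i j) ⟩
    F i j                            ∎

module _ {k n : ℕ} where

  rowOnes-∑ : (M : Matrix k n) (r : Fin k) → rowOnes M r ≡ ∑ (λ c → ind (M r c))
  rowOnes-∑ M r = count-allFin (M r)

  ones-∑ : (M : Matrix k n) → ones M ≡ ∑ (rowOnes M)
  ones-∑ M = listSum-allFin (rowOnes M)

  ones-∑₂ : (M : Matrix k n) → ones M ≡ ∑₂ (λ r c → ind (M r c))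
  ones-∑₂ M = trans (ones-∑ M) (sum-cong-≗ (rowOnes-∑ M))

  -- Columns c < c' on which rows r and r' both have 1s; for r ≠ r' these
  -- are the occurrences of S on the rows r, r'.
  rectangle : Matrix k n → Fin k → Fin k → Fin n → Fin n → Bool
  rectangle M r r' c c' = (toℕ c <ᵇ toℕ c') ∧ M r c ∧ M r c' ∧ M r' c ∧ M r' c'

  rectangles : Matrix k n → Fin k → Fin k → ℕ
  rectangles M r r' = ∑₂ λ c c' → ind (rectangle M r r' c c')

  rowRectangles : Matrix k n → Fin k → ℕ
  rowRectangles M r = ∑ (rectangles M r)

  occS-∑ : (M : Matrix k n) → occS M ≡ ∑₂ (λ r r' → lt r r' * rectangles M r r')
  occS-∑ M = begin
    occS M                                       ≡⟨ listSum-allFin₂ pairCount ⟩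
    ∑₂ pairCount                                 ≡⟨ ∑₂-cong pairCount-∑ ⟩
    ∑₂ (λ r r' → lt r r' * rectangles M r r')    ∎
    where
    open ≡-Reasoning
    occurrence : Fin k → Fin k → Fin n → Fin n → Bool
    occurrence r r' c c' = (toℕ r <ᵇ toℕ r') ∧ rectangle M r r' c c'
    pairCount : Fin k → Fin k → ℕ
    pairCount r r' = listSum (map (λ c → count (occurrence r r' c) (allFin n)) (allFin n))
    pairCount-∑ : ∀ r r' → pairCount r r' ≡ lt r r' * rectangles M r r'
    pairCount-∑ r r' = begin
      pairCount r r'
        ≡⟨ listSum-allFin (λ c → count (occurrence r r' c) (allFin n)) ⟩
      ∑ (λ c → count (occurrence r r' c) (allFin n))
        ≡⟨ sum-cong-≗ (λ c → count-allFin (occurrence r r' c)) ⟩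
      ∑₂ (λ c c' → ind (occurrence r r' c c'))
        ≡⟨ ∑₂-cong (λ c c' → ind-∧ (toℕ r <ᵇ toℕ r') (rectangle M r r' c c')) ⟩
      ∑₂ (λ c c' → lt r r' * ind (rectangle M r r' c c'))
        ≡⟨ ∑₂-*ˡ (lt r r') (λ c c' → ind (rectangle M r r' c c')) ⟨
      lt r r' * rectangles M r r' ∎

  rectangles-sym : (M : Matrix k n) (r r' : Fin k) → rectangles M r' r ≡ rectangles M r r'
  rectangles-sym M r r' = ∑₂-cong λ c c' →
    cong (λ b → ind ((toℕ c <ᵇ toℕ c') ∧ b)) (swap-pairs (M r' c) (M r' c') (M r c) (M r c'))
    where
    open ≡-Reasoning
    swap-pairs : ∀ a b c d → a ∧ b ∧ c ∧ d ≡ c ∧ d ∧ a ∧ b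
    swap-pairs a b c d = begin
      a ∧ b ∧ c ∧ d      ≡⟨ ∧-assoc a b (c ∧ d) ⟨
      (a ∧ b) ∧ (c ∧ d)  ≡⟨ ∧-comm (a ∧ b) (c ∧ d) ⟩
      (c ∧ d) ∧ (a ∧ b)  ≡⟨ ∧-assoc c d (a ∧ b) ⟩
      c ∧ d ∧ a ∧ b      ∎

  -- Every occurrence of S is a rectangle through each of its two rows.
  twice-occS≤ : (M : Matrix k n) → 2 * occS M ≤ ∑ (rowRectangles M)
  twice-occS≤ M = begin
    2 * occS M
      ≡⟨ cong (2 *_) (occS-∑ M) ⟩
    2 * ∑₂ (λ r r' → lt r r' * rectangles M r r')
      ≡⟨ ∑₂-*ˡ 2 (λ r r' → lt r r' * rectangles M r r') ⟩
    ∑₂ (λ r r' → 2 * (lt r r' * rectangles M r r'))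
      ≡⟨ ∑₂-cong both-orders ⟩
    ∑₂ (λ r r' → lt r r' * (rectangles M r r' + rectangles M r' r))
      ≤⟨ ∑₂-upper-pairs (rectangles M) ⟩
    ∑ (rowRectangles M) ∎
    where
    open ≤-Reasoning
    both-orders : ∀ r r' →
      2 * (lt r r' * rectangles M r r') ≡ lt r r' * (rectangles M r r' + rectangles M r' r)
    both-orders r r' rewrite rectangles-sym M r r' =
      trans (cong (lt r r' * rectangles M r r' +_) (+-identityʳ _))
            (sym (*-distribˡ-+ (lt r r') (rectangles M r r') (rectangles M r r')))

  rowRectangles-pos : (M : Matrix k n) (r : Fin k) → 0 < rowRectangles M r → 2 ≤ rowOnes M r
  rowRectangles-pos M r pos
    with ∑-pos (rectangles M r) pos
  ... | r' , pos' with ∑-pos (λ c → ∑ λ c' → ind (rectangle M r r' c c')) pos'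
  ... | c , pos'' with ∑-pos (λ c' → ind (rectangle M r r' c c')) pos''
  ... | c' , pos''' with T-first-three (toℕ c <ᵇ toℕ c') (M r c) (M r c') (ind-pos pos''')
  ... | c<c' , Mrc , Mrc' = begin
    2                            ≡⟨ cong₂ _+_ (ind-T Mrc) (ind-T Mrc') ⟨
    ind (M r c) + ind (M r c')   ≤⟨ two-terms≤∑ (λ j → ind (M r j)) (<ᵇ⇒≢ c<c') ⟩
    ∑ (λ j → ind (M r j))        ≡⟨ rowOnes-∑ M r ⟨
    rowOnes M r                  ∎
    where
    open ≤-Reasoning

  _⊑_ : Matrix k n → Matrix k n → Set
  M' ⊑ M = ∀ r c → T (M' r c) → T (M r c)

  lostEntry : Matrix k n → Matrix k n → Fin k → Fin n → Bool
  lostEntry M M' r c = M r c ∧ not (M' r c)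

  lost : Matrix k n → Matrix k n → ℕ
  lost M M' = ∑₂ λ r c → ind (lostEntry M M' r c)

  ones-⊑ : ∀ {M M'} → M' ⊑ M → ones M' + lost M M' ≤ ones M
  ones-⊑ {M} {M'} M'⊑M = begin
    ones M' + lost M M'
      ≡⟨ cong (_+ lost M M') (ones-∑₂ M') ⟩
    ∑₂ (λ r c → ind (M' r c)) + lost M M'
      ≡⟨ ∑₂-distrib-+ (λ r c → ind (M' r c)) (λ r c → ind (lostEntry M M' r c)) ⟨
    ∑₂ (λ r c → ind (M' r c) + ind (lostEntry M M' r c))
      ≤⟨ ∑₂-mono (λ r c → kept-or-lost (M'⊑M r c)) ⟩
    ∑₂ (λ r c → ind (M r c))
      ≡⟨ ones-∑₂ M ⟨
    ones M ∎
    where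
    open ≤-Reasoning
    kept-or-lost : ∀ {a a'} → (T a' → T a) → ind a' + ind (a ∧ not a') ≤ ind a
    kept-or-lost {true}  {true}  _ = ≤-refl
    kept-or-lost {true}  {false} _ = ≤-refl
    kept-or-lost {false} {false} _ = z≤n
    kept-or-lost {false} {true}  a'⇒a = ⊥-elim (a'⇒a tt)

  rowOnes-⊑ : ∀ {M M'} → M' ⊑ M → ∀ r → rowOnes M' r ≤ rowOnes M r
  rowOnes-⊑ {M} {M'} M'⊑M r = begin
    rowOnes M' r              ≡⟨ rowOnes-∑ M' r ⟩
    ∑ (λ c → ind (M' r c))    ≤⟨ ∑-mono (λ c → ind-mono (M'⊑M r c)) ⟩
    ∑ (λ c → ind (M r c))     ≡⟨ rowOnes-∑ M r ⟨
    rowOnes M r               ∎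
    where open ≤-Reasoning

  sparseRows : Matrix k n → ℕ
  sparseRows M = count (λ r → rowOnes M r ≤ᵇ 1) (allFin k)

  sparseRows-⊑ : ∀ {M M'} → M' ⊑ M → ∀ r → 2 ≤ rowOnes M r → rowOnes M' r ≤ 1 →
    sparseRows M + 1 ≤ sparseRows M'
  sparseRows-⊑ {M} {M'} M'⊑M r dense sparse = begin
    sparseRows M + 1                          ≡⟨ +-comm (sparseRows M) 1 ⟩
    suc (sparseRows M)                        ≡⟨ cong suc (count-allFin (sparse? M)) ⟩
    suc (∑ (λ j → ind (sparse? M j)))         ≤⟨ ∑-mono-< stays-sparse r becomes-sparse ⟩
    ∑ (λ j → ind (sparse? M' j))              ≡⟨ count-allFin (sparse? M') ⟨
    sparseRows M'                             ∎
    where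
    open ≤-Reasoning
    sparse? : Matrix k n → Fin k → Bool
    sparse? X j = rowOnes X j ≤ᵇ 1
    stays-sparse : ∀ j → ind (sparse? M j) ≤ ind (sparse? M' j)
    stays-sparse j = ind-mono λ t →
      ≤⇒≤ᵇ (≤-trans (rowOnes-⊑ M'⊑M j) (≤ᵇ⇒≤ (rowOnes M j) 1 t))
    becomes-sparse : ind (sparse? M r) < ind (sparse? M' r)
    becomes-sparse = ind-< (λ t → <⇒≱ dense (≤ᵇ⇒≤ (rowOnes M r) 1 t)) (≤⇒≤ᵇ sparse)

choose-row : ∀ {k n} (M : Matrix k n) → 0 < ones M → 0 < occS M →
  ∃[ r ] 2 * occS M * rowOnes M r ≤ rowRectangles M r * ones M × 0 < rowRectangles M r
choose-row M 0<N 0<occ =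
  let (r , share , 0<rect*N) = averaging (λ r → rowRectangles M r * ones M)
                                         (λ r → 2 * occS M * rowOnes M r) rows-compare positive
  in r , share , pos-*ˡ (rowRectangles M r) 0<rect*N
  where
  open ≤-Reasoning
  occS-bound : 2 * occS M * ones M ≤ ∑ λ r → rowRectangles M r * ones M
  occS-bound = begin
    2 * occS M * ones M                   ≤⟨ *-monoˡ-≤ (ones M) (twice-occS≤ M) ⟩
    ∑ (rowRectangles M) * ones M          ≡⟨ *-distribʳ-sum (ones M) (rowRectangles M) ⟩
    ∑ (λ r → rowRectangles M r * ones M)  ∎
  rows-compare : ∑ (λ r → 2 * occS M * rowOnes M r) ≤ ∑ λ r → rowRectangles M r * ones M
  rows-compare = begin
    ∑ (λ r → 2 * occS M * rowOnes M r)    ≡⟨ *-distribˡ-sum (2 * occS M) (rowOnes M) ⟨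
    2 * occS M * ∑ (rowOnes M)            ≡⟨ cong (2 * occS M *_) (ones-∑ M) ⟨
    2 * occS M * ones M                   ≤⟨ occS-bound ⟩
    ∑ (λ r → rowRectangles M r * ones M)  ∎
  positive : 0 < ∑ λ r → rowRectangles M r * ones M
  positive = <-≤-trans (*-pos (*-pos {2} z<s 0<occ) 0<N) occS-bound

module _ {k n : ℕ} where

  wordMatrix⁻ : ∀ (w : Word k n) r c → T (wordMatrix w r c) → lookup w r ≡ c
  wordMatrix⁻ w r c = toWitness {a? = lookup w r ≟ᶠ c}

  wordMatrix⁺ : ∀ (w : Word k n) r c → lookup w r ≡ c → T (wordMatrix w r c)
  wordMatrix⁺ w r c = fromWitness

  overall⁻ : ∀ {V : List (Word k n)} {r c} → T (overall V r c) → ∃[ w ] w ∈ V × lookup w r ≡ c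
  overall⁻ {V} {r} {c} t with find (any⁻ (λ w → wordMatrix w r c) V t)
  ... | w , w∈V , entry = w , w∈V , wordMatrix⁻ w r c entry

  overall⁺ : ∀ {V : List (Word k n)} {w r c} → w ∈ V → lookup w r ≡ c → T (overall V r c)
  overall⁺ {w = w} {r} {c} w∈V wr≡c =
    any⁺ (λ w → wordMatrix w r c) (lose w∈V (wordMatrix⁺ w r c wr≡c))

module _ {k n : ℕ} (U : List (Word k n)) where

  restrict : Fin k → Fin n → List (Word k n)
  restrict r c = filterᵇ (λ w → wordMatrix w r c) U

  restrict-⊆ : ∀ r c → restrict r c ⊆ U
  restrict-⊆ r c = filter-⊆ (λ w → T? (wordMatrix w r c)) U

  restrict-entry : ∀ {r c r' c'} → T (overall (restrict r c) r' c') →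
    ∃[ w ] w ∈ U × lookup w r ≡ c × lookup w r' ≡ c'
  restrict-entry {r} {c} t with overall⁻ t
  ... | w , w∈U[r,c] , wr'≡c' with ∈-filter⁻ (λ w → T? (wordMatrix w r c)) w∈U[r,c]
  ...   | w∈U , entry = w , w∈U , wordMatrix⁻ w r c entry , wr'≡c'

  overall-restrict-⊑ : ∀ r c → overall (restrict r c) ⊑ overall U
  overall-restrict-⊑ r c r' c' t with restrict-entry t
  ... | w , w∈U , _ , wr'≡c' = overall⁺ w∈U wr'≡c'

  rowOnes-restrict : ∀ r c → rowOnes (overall (restrict r c)) r ≤ 1
  rowOnes-restrict r c = begin
    rowOnes A' r                 ≡⟨ rowOnes-∑ A' r ⟩
    ∑ (λ c' → ind (A' r c'))     ≡⟨ ∑-single (λ c' → ind (A' r c')) c elsewhere ⟩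
    ind (A' r c)                 ≤⟨ ind≤1 (A' r c) ⟩
    1                            ∎
    where
    open ≤-Reasoning
    A' = overall (restrict r c)
    elsewhere : ∀ c' → c' ≢ c → ind (A' r c') ≡ 0
    elsewhere c' c'≢c with A' r c' in eq
    ... | false = refl
    ... | true with restrict-entry (subst T (sym eq) tt)
    ...   | w , _ , wr≡c , wr≡c' = ⊥-elim (c'≢c (trans (sym wr≡c') wr≡c))

  -- Reverse-freeness: for c ≠ c', the entries (r', c') of A_{U_{r,c}} and
  -- (r', c) of A_{U_{r,c'}} are never both 1, since their witnesses would
  -- form a reverse at the positions r, r'.
  no-crossing : ReverseFree U → ∀ {r r' c c'} → c ≢ c' →
    T (overall (restrict r c) r' c') → T (overall (restrict r c') r' c) → ⊥
  no-crossing reverseFree {r} {r'} c≢c' t t' with restrict-entry t | restrict-entry t'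
  ... | w , w∈U , wr≡c , wr'≡c' | x , x∈U , xr≡c' , xr'≡c =
    reverseFree w x w∈U x∈U
      (r , r' , (λ e → c≢c' (trans (sym wr≡c) (trans e wr'≡c')))
              , trans wr≡c (sym xr'≡c) , trans wr'≡c' (sym xr≡c'))

  loss : Fin k → Fin n → ℕ
  loss r c = lost (overall U) (overall (restrict r c))

  sizeA-restrict : ∀ r c → sizeA (restrict r c) + loss r c ≤ sizeA U
  sizeA-restrict r c = ones-⊑ (overall-restrict-⊑ r c)

  -- Without light entries, U_{r,c} keeps at least |U|/n words for every
  -- 1-entry (r, c) of A_U (its size is the number of hits at (r, c)).
  restrict-large : NoLight U → ∀ {r c} → T (overall U r c) → length U ≤ n * length (restrict r c)
  restrict-large noLight {r} {c} t = ≰⇒≥ λ light → noLight r c (Equivalence.to T-≡ t , light)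

  emptiness-restrict : ∀ {r} c → 2 ≤ rowOnes (overall U) r → emptiness U + 1 ≤ emptiness (restrict r c)
  emptiness-restrict {r} c dense =
    sparseRows-⊑ (overall-restrict-⊑ r c) r dense (rowOnes-restrict r c)

-- Boolean core of the key estimate: a rectangle on columns c < c' (with
-- 1-entries a, b in row r and c, d in row r') is charged to the loss of the
-- entry d in U_{r,c} or of the entry c in U_{r,c'}, as the two entries e, e'
-- that would survive cannot both do so.
rectangle-charge : ∀ l a b c d e e' → (T l → T e → T e' → ⊥) →
  ind (l ∧ a ∧ b ∧ c ∧ d) ≤ ind l * (ind (a ∧ d ∧ not e) + ind (b ∧ c ∧ not e'))
rectangle-charge false _     _     _     _     _     _     _ = z≤n
rectangle-charge true  false _     _     _     _     _     _ = z≤n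
rectangle-charge true  true  false _     _     _     _     _ = z≤n
rectangle-charge true  true  true  false _     _     _     _ = z≤n
rectangle-charge true  true  true  true  false _     _     _ = z≤n
rectangle-charge true  true  true  true  true  false _     _ = s≤s z≤n
rectangle-charge true  true  true  true  true  true  false _ = s≤s z≤n
rectangle-charge true  true  true  true  true  true  true  crossing = ⊥-elim (crossing tt tt tt)

module _ {k n : ℕ} (U : List (Word k n)) (reverseFree : ReverseFree U) where

  private
    A : Matrix k n
    A = overall U

    A[_,_] : Fin k → Fin n → Matrix k n
    A[ r , c ] = overall (restrict U r c)

    lostAt : Fin k → Fin n → Fin k → Fin n → ℕ
    lostAt r c r' c' = ind (lostEntry A A[ r , c ] r' c')

    lossInRow : Fin k → Fin n → Fin k → ℕ
    lossInRow r c r' = ∑ (lostAt r c r')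

  rectangles≤loss : ∀ r r' → rectangles A r r' ≤ ∑ λ c → ind (A r c) * lossInRow r c r'
  rectangles≤loss r r' = begin
    rectangles A r r'
      ≤⟨ ∑₂-mono (λ c c' →
           rectangle-charge (toℕ c <ᵇ toℕ c') (A r c) (A r c') (A r' c) (A r' c')
             (A[ r , c ] r' c') (A[ r , c' ] r' c)
             (λ c<c' → no-crossing U reverseFree (<ᵇ⇒≢ c<c'))) ⟩
    ∑₂ (λ c c' → lt c c' * (charge c c' + charge c' c))
      ≤⟨ ∑₂-upper-pairs charge ⟩
    ∑₂ charge
      ≡⟨ ∑₂-cong (λ c c' → ind-∧ (A r c) (lostEntry A A[ r , c ] r' c')) ⟩
    ∑₂ (λ c c' → ind (A r c) * lostAt r c r' c')
      ≡⟨ sum-cong-≗ (λ c → *-distribˡ-sum (ind (A r c)) (lostAt r c r')) ⟨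
    ∑ (λ c → ind (A r c) * lossInRow r c r') ∎
    where
    open ≤-Reasoning
    charge : Fin n → Fin n → ℕ
    charge c c' = ind (A r c ∧ lostEntry A A[ r , c ] r' c')

  rowRectangles≤loss : ∀ r → rowRectangles A r ≤ ∑ λ c → ind (A r c) * loss U r c
  rowRectangles≤loss r = begin
    ∑ (rectangles A r)
      ≤⟨ ∑-mono (rectangles≤loss r) ⟩
    ∑₂ (λ r' c → ind (A r c) * lossInRow r c r')
      ≡⟨ ∑-comm (λ r' c → ind (A r c) * lossInRow r c r') ⟩
    ∑₂ (λ c r' → ind (A r c) * lossInRow r c r')
      ≡⟨ sum-cong-≗ (λ c → *-distribˡ-sum (ind (A r c)) (lossInRow r c)) ⟨
    ∑ (λ c → ind (A r c) * loss U r c) ∎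
    where open ≤-Reasoning

  choose-column : ∀ r → 0 < rowRectangles A r →
    ∃[ c ] T (A r c) × rowRectangles A r ≤ rowOnes A r * loss U r c
  choose-column r 0<rect =
    let (c , 0<Arc , share) = weighted-averaging (λ c → ind (A r c)) (λ c → rowOnes A r * loss U r c)
                                (rowRectangles A r) total positive
    in c , ind-pos 0<Arc , share
    where
    open ≤-Reasoning
    total : ∑ (λ c → ind (A r c)) * rowRectangles A r ≤ ∑ λ c → ind (A r c) * (rowOnes A r * loss U r c)
    total = begin
      ∑ (λ c → ind (A r c)) * rowRectangles A r
        ≡⟨ cong (_* rowRectangles A r) (rowOnes-∑ A r) ⟨
      rowOnes A r * rowRectangles A r
        ≤⟨ *-monoʳ-≤ (rowOnes A r) (rowRectangles≤loss r) ⟩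
      rowOnes A r * ∑ (λ c → ind (A r c) * loss U r c)
        ≡⟨ *-distribˡ-sum (rowOnes A r) (λ c → ind (A r c) * loss U r c) ⟩
      ∑ (λ c → rowOnes A r * (ind (A r c) * loss U r c))
        ≡⟨ sum-cong-≗ (λ c → x∙yz≈y∙xz (rowOnes A r) (ind (A r c)) (loss U r c)) ⟩
      ∑ (λ c → ind (A r c) * (rowOnes A r * loss U r c)) ∎
    positive : 0 < ∑ (λ c → ind (A r c)) * rowRectangles A r
    positive = subst (λ R → 0 < R * rowRectangles A r) (rowOnes-∑ A r)
                 (*-pos (≤-trans (s≤s z≤n) (rowRectangles-pos A r 0<rect)) 0<rect)

-- The final arithmetic.  From a loss L ≥ T/R, a row share T/R ≥ 2·occ/N and
-- supersaturation N⁴ ≤ K·occ we get L ≥ 2N³/K, so the restriction, of size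
-- at most N − L, satisfies K·S + 2N³ ≤ K·N.
loss-arithmetic : ∀ K N S R T L occ → S + L ≤ N → T ≤ R * L → 2 * occ * R ≤ T * N →
  N ^ 4 ≤ K * occ → 0 < R → 0 < N → K * S + 2 * N ^ 3 ≤ K * N
loss-arithmetic K N S R T L occ size T≤RL share supersat 0<R 0<N = begin
  K * S + 2 * N ^ 3   ≤⟨ +-monoʳ-≤ (K * S) loss-large ⟩
  K * S + K * L       ≡⟨ *-distribˡ-+ K S L ⟨
  K * (S + L)         ≤⟨ *-monoʳ-≤ K size ⟩
  K * N               ∎
  where
  open ≤-Reasoning
  open +-*-Solver
  occ-small : 2 * occ ≤ L * N
  occ-small = *-cancelˡ-≤ R {{>-nonZero 0<R}} (begin
    R * (2 * occ)  ≡⟨ solve 2 (λ r o → r :* (con 2 :* o) := con 2 :* o :* r) refl R occ ⟩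
    2 * occ * R    ≤⟨ share ⟩
    T * N          ≤⟨ *-monoˡ-≤ N T≤RL ⟩
    R * L * N      ≡⟨ *-assoc R L N ⟩
    R * (L * N)    ∎)
  loss-large : 2 * N ^ 3 ≤ K * L
  loss-large = *-cancelˡ-≤ N {{>-nonZero 0<N}} (begin
    N * (2 * N ^ 3)  ≡⟨ solve 1 (λ x → x :* (con 2 :* x :^ 3) := con 2 :* x :^ 4) refl N ⟩
    2 * N ^ 4        ≤⟨ *-monoʳ-≤ 2 supersat ⟩
    2 * (K * occ)    ≡⟨ x∙yz≈y∙xz 2 K occ ⟩
    K * (2 * occ)    ≤⟨ *-monoʳ-≤ K occ-small ⟩
    K * (L * N)      ≡⟨ solve 3 (λ k l x → k :* (l :* x) := x :* (k :* l)) refl K L N ⟩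
    N * (K * L)      ∎)

claim2 : (n₀ : ℕ) → 1 ≤ n₀ → SupersatHyp n₀ →
  (n k : ℕ) → n₀ ≤ n → 1 ≤ k → k ≤ n →
  (U : List (Word k n)) → Unique U → ReverseFree U →
  DensityAtLeast5 n k (sizeA U) → NoLight U →
  Σ (List (Word k n)) λ U' → (U' ⊆ U) ×
    (length U ≤ n * length U') ×
    (5 * (n ^ 2) * (k ^ 2) * sizeA U' + 2 * sizeA U ^ 3 ≤ 5 * (n ^ 2) * (k ^ 2) * sizeA U) ×
    (emptiness U + 1 ≤ emptiness U')
claim2 n₀ 1≤n₀ supersaturation n k n₀≤n 1≤k k≤n U _ reverseFree dense noLight =
  let (r , row-share , 0<rect)    = choose-row A 0<N 0<occ
      (c , Arc , column-share)    = choose-column U reverseFree r 0<rect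
      two-ones                    = rowRectangles-pos A r 0<rect
  in restrict U r c , restrict-⊆ U r c , restrict-large U noLight Arc ,
     loss-arithmetic K N (sizeA (restrict U r c)) (rowOnes A r) (rowRectangles A r) (loss U r c)
       (occS A) (sizeA-restrict U r c) column-share row-share supersaturated
       (≤-trans (s≤s z≤n) two-ones) 0<N ,
     emptiness-restrict U c two-ones
  where
  A : Matrix k n
  A = overall U
  N K : ℕ
  N = sizeA U
  K = 5 * (n ^ 2) * (k ^ 2)
  supersaturated : N ^ 4 ≤ K * occS A
  supersaturated = supersaturation n k n₀≤n 1≤k k≤n A dense
  0<N : 0 < N
  0<N = pos-of-pow N 1 (*-pos (*-pos {25} z<s (^-pos 2 (≤-trans 1≤n₀ n₀≤n))) 1≤k) dense
  0<occ : 0 < occS A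
  0<occ = pos-*ʳ K (<-≤-trans (^-pos 4 0<N) supersaturated)
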